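{- Let $n\geq 2k+1$, $x\in X_{n,k}$, and let $\gamma=(A,B)\in\Gamma(x)$ be an inverted glider. Then the step of $\widehat{x}$ at position $\max B+1$ is a down-step, i.e., the corresponding bit of $x$ is a matched $0$.
   Context: Let $k\geq1$, $n\geq 2k+1$, and $X_{n,k}$ be the set of binary strings of length $n$ with exactly $k$ ones, indices taken cyclically. Parenthesis matching: regarding $x$ cyclically, each $1$ is matched to the last $0$ of the shortest cyclic substring starting at this $1$ and going rightwards that contains equally many $0$s and $1$s; every $1$ is matched, and $n-2k$ zeros are unmatched. Let $\widehat{x}$ be the bi-infinite string with $\widehat{x}_i=x_{i \bmod n}$ for $i\in\mathbb{Z}$, with matched/unmatched status inherited, viewed as a lattice path: matched $1$ = up-step, matched $0$ = down-step, unmatched $0$ = flat step, heights normalized so flat steps lie at height $0$. Let $D$ be the set of Dyck words, $\varepsilon$ the empty word, $D'=\{1u0:u\in D\}$, and $\overline{z}$ the bitwise complement of $z$. A subword of $\widehat{x}$ on an interval of positions is a hill if it lies in $D$ and a valley if its complement lies in $D$. Every $y\in D'$ of height $h$ decomposes uniquely as $y=10$ if $h=1$, and otherwise as $y=1u_1\,1u_2\cdots 1u_{h-2}\,1\,1\,v_0\,0\,v_1\,0\cdots 0\,v_{h-2}\,0\,0$ with $u_i\in D$, $\overline{v_i}\in D$. For a word $y$ occupying consecutive positions of $\mathbb{Z}$ (positions retained): $\Gamma(\varepsilon)=\emptyset$; if $y\in D\setminus(D'\cup\{\varepsilon\})$, $y=y_1\cdots y_\ell$ with $y_i\in D'$,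 then $\Gamma(y)=\bigcup_i\Gamma(y_i)$; if $y\in D'$, $\Gamma(y)=\bigcup_{i=1}^{h-2}\Gamma(u_i)\cup\bigcup_{i=0}^{h-2}\Gamma(\overline{v_i})\cup\{(A,B)\}$, where $\overline{v_i}$ is the complemented word occupying the same positions as $v_i$ (the recursion is applied to it in place), $A$ is the set of positions of the $1$s of $y$ not in any $u_i$ or $v_i$, and $B$ the set of positions of the $0$s of $y$ not in any $u_i$ or $v_i$. $\Gamma(x)=\bigcup\Gamma(y)$ over all subwords $y\in D'$ of $\widehat{x}$ starting and ending at height $0$; its elements are gliders. For a glider $\gamma=(A,B)$, its range is $r(\gamma)=[\min A,\max B]$; $\gamma$ is inverted if the subword of $\widehat{x}$ on $r(\gamma)$ is a valley (and non-inverted if it is a hill). -}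

module Defs where

open import Data.Bool using (Bool; true; false; not)
open import Data.Nat as ℕ using (ℕ; zero; suc; NonZero)
open import Data.Integer as ℤ using (ℤ; +_; _⊔_)
open import Data.Integer.DivMod using (_%ℕ_; n%ℕd<d)
open import Data.Fin using (Fin; toℕ; fromℕ<)
open import Data.Vec using (Vec; lookup)
open import Data.List using (List; []; _∷_; _++_; length; map; concat; concatMap)
open import Data.List.Relation.Unary.All using (All)
open import Data.List.Membership.Propositional using (_∈_)
open import Data.Product using (Σ; ∃; _×_; _,_)
open import Relation.Binary.PropositionalEquality using (_≡_)
open import Relation.Nullary using (¬_)

ones : ∀ {n} → Vec Bool n → ℕ
ones Data.Vec.[] = 0
ones (true Data.Vec.∷ x) = suc (ones x)
ones (false Data.Vec.∷ x) = ones x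

InX : (n k : ℕ) → Vec Bool n → Set
InX n k x = ones x ≡ k

modFin : (n : ℕ) .{{_ : NonZero n}} → ℤ → Fin n
modFin n i = fromℕ< (n%ℕd<d i n)

xhat : ∀ {n} .{{_ : NonZero n}} → Vec Bool n → ℤ → Bool
xhat {n} x i = lookup x (modFin n i)

sub : (ℤ → Bool) → ℤ → ℕ → List Bool
sub w a zero = []
sub w a (suc L) = w a ∷ sub w (a ℤ.+ + 1) L

bal : List Bool → ℤ
bal [] = + 0
bal (true ∷ w) = + 1 ℤ.+ bal w
bal (false ∷ w) = ℤ.- (+ 1) ℤ.+ bal w

Balanced : List Bool → Set
Balanced w = bal w ≡ + 0

ShortestBalanced : ∀ {n} .{{_ : NonZero n}} → Vec Bool n → Fin n → ℕ → Set
ShortestBalanced x i L =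
  1 ℕ.≤ L × Balanced (sub (xhat x) (+ toℕ i) L)
  × (∀ L' → 1 ℕ.≤ L' → L' ℕ.< L → ¬ Balanced (sub (xhat x) (+ toℕ i) L'))

-- the bit at position j ∈ Fin n of x is a matched 0: it is the last 0 of the
-- shortest balanced cyclic substring starting at some 1 of x
MatchedZero : ∀ {n} .{{_ : NonZero n}} → Vec Bool n → Fin n → Set
MatchedZero {n} x j =
  lookup x j ≡ false ×
  Σ (Fin n) λ i → Σ ℕ λ L → Σ ℕ λ t →
    lookup x i ≡ true × ShortestBalanced x i L
    × t ℕ.< L × xhat x (+ toℕ i ℤ.+ + t) ≡ false
    × (∀ t' → t ℕ.< t' → t' ℕ.< L → xhat x (+ toℕ i ℤ.+ + t') ≡ true)
    × modFin n (+ toℕ i ℤ.+ + t) ≡ j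

MatchedZeroHat : ∀ {n} .{{_ : NonZero n}} → Vec Bool n → ℤ → Set
MatchedZeroHat {n} x j = MatchedZero x (modFin n j)

UnmatchedZeroHat : ∀ {n} .{{_ : NonZero n}} → Vec Bool n → ℤ → Set
UnmatchedZeroHat x j = xhat x j ≡ false × ¬ MatchedZeroHat x j

-- h is the height function of the lattice path of \hat{x}:
-- h j is the height before the step at position j, h (j+1) the height after it;
-- matched 1 = up-step, matched 0 = down-step, unmatched 0 = flat step,
-- normalized so that flat steps lie at height 0.
IsHeight : ∀ {n} .{{_ : NonZero n}} → Vec Bool n → (ℤ → ℤ) → Set
IsHeight x h = ∀ j →
    (xhat x j ≡ true → h (j ℤ.+ + 1) ≡ h j ℤ.+ + 1)
  × (MatchedZeroHat x j → h (j ℤ.+ + 1) ≡ h j ℤ.- + 1)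
  × (UnmatchedZeroHat x j → h (j ℤ.+ + 1) ≡ h j × h j ≡ + 0)

-- Dyck words (1 = up, 0 = down)

data Dyck : List Bool → Set where
  ε   : Dyck []
  cat : ∀ {u v} → Dyck u → Dyck v → Dyck (true ∷ u ++ false ∷ v)

Dyck' : List Bool → Set
Dyck' y = Σ (List Bool) λ u → Dyck u × y ≡ true ∷ u ++ false ∷ []

compl : List Bool → List Bool
compl = map not

-- height (maximal height of a prefix) of a word viewed as a path from 0
height : List Bool → ℤ
height [] = + 0
height (true ∷ w) = + 0 ⊔ (+ 1 ℤ.+ height w)
height (false ∷ w) = + 0 ⊔ (ℤ.- (+ 1) ℤ.+ height w)

data Seg : Set where
  oneA  : Seg
  zeroB : Seg
  blkU  : List Bool → Seg    -- a block u_i ∈ D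
  blkV  : List Bool → Seg    -- a block v_i with complement in D

segWord : Seg → List Bool
segWord oneA = true ∷ []
segWord zeroB = false ∷ []
segWord (blkU u) = u
segWord (blkV v) = v

flatten : List Seg → List Bool
flatten ss = concat (map segWord ss)

-- 1u_1 1u_2 ⋯ 1u_{h-2} 1 1 v_0 0 v_1 0 ⋯ 0 v_{h-2} 0 0
layout : List (List Bool) → List Bool → List (List Bool) → List Seg
layout us v0 vs =
  concatMap (λ u → oneA ∷ blkU u ∷ []) us
  ++ oneA ∷ oneA ∷ blkV v0 ∷ concatMap (λ v → zeroB ∷ blkV v ∷ []) vs
  ++ zeroB ∷ zeroB ∷ []

data Decomp (y : List Bool) : List Seg → Set where
  h1 : y ≡ true ∷ false ∷ [] → Decomp y (oneA ∷ zeroB ∷ [])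
  h≥2 : ∀ us v0 vs →
        length vs ≡ length us →              -- h - 2 blocks u_i and v_1 … v_{h-2}
        height y ≡ + (2 ℕ.+ length us) →
        All Dyck us →
        All (λ v → Dyck (compl v)) (v0 ∷ vs) →
        y ≡ flatten (layout us v0 vs) →
        Decomp y (layout us v0 vs)

-- positions (starting at offset a) of the A-ones, the B-zeros, and the blocks
-- (block start, word on which Γ recurses: u_i itself, or the complement of v_i)
posA : ℤ → List Seg → List ℤ
posA a [] = []
posA a (oneA ∷ ss) = a ∷ posA (a ℤ.+ + 1) ss
posA a (s ∷ ss) = posA (a ℤ.+ + length (segWord s)) ss

posB : ℤ → List Seg → List ℤ
posB a [] = []
posB a (zeroB ∷ ss) = a ∷ posB (a ℤ.+ + 1) ss
posB a (s ∷ ss) = posB (a ℤ.+ + length (segWord s)) ss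

blocks : ℤ → List Seg → List (ℤ × List Bool)
blocks a [] = []
blocks a (blkU u ∷ ss) = (a , u) ∷ blocks (a ℤ.+ + length u) ss
blocks a (blkV v ∷ ss) = (a , compl v) ∷ blocks (a ℤ.+ + length v) ss
blocks a (s ∷ ss) = blocks (a ℤ.+ + length (segWord s)) ss

Glider : Set
Glider = List ℤ × List ℤ

mutual
  -- γ ∈ Γ(y) for y ∈ D (y = y_1 ⋯ y_ℓ with y_i ∈ D'; Γ(ε) = ∅)
  data GamD (a : ℤ) : List Bool → Glider → Set where
    here  : ∀ {p r γ} → Dyck' p → Dyck r → GamP a p γ → GamD a (p ++ r) γ
    there : ∀ {p r γ} → Dyck' p → Dyck r →
            GamD (a ℤ.+ + length p) r γ → GamD a (p ++ r) γ

  data GamP (a : ℤ) : List Bool → Glider → Set where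
    top : ∀ {y ss} → Dyck' y → Decomp y ss → GamP a y (posA a ss , posB a ss)
    rec : ∀ {y ss b w γ} → Dyck' y → Decomp y ss →
          (b , w) ∈ blocks a ss → GamD b w γ → GamP a y γ

-- γ ∈ Γ(x): γ ∈ Γ(y) for a subword y ∈ D' of \hat{x} (positions a … a+L-1)
-- starting and ending at height 0
InGamma : ∀ {n} .{{_ : NonZero n}} → Vec Bool n → (ℤ → ℤ) → Glider → Set
InGamma x h γ = Σ ℤ λ a → Σ ℕ λ L →
  Dyck' (sub (xhat x) a L) × h a ≡ + 0 × h (a ℤ.+ + L) ≡ + 0
  × GamP a (sub (xhat x) a L) γ

IsMin : ℤ → List ℤ → Set
IsMin m A = m ∈ A × All (m ℤ.≤_) A

IsMax : ℤ → List ℤ → Set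
IsMax m B = m ∈ B × All (ℤ._≤ m) B

ValleyOn : ∀ {n} .{{_ : NonZero n}} → Vec Bool n → ℤ → ℤ → Set
ValleyOn x lo hi = Σ ℕ λ L → lo ℤ.+ + L ≡ hi ℤ.+ + 1 × Dyck (compl (sub (xhat x) lo L))

Inverted : ∀ {n} .{{_ : NonZero n}} → Vec Bool n → Glider → Set
Inverted x (A , B) = ∀ lo hi → IsMin lo A → IsMax hi B → ValleyOn x lo hi

-- The glider γ is produced inside a word y ∈ D' of x̂ that starts and ends at
-- height 0, after descending through a chain of blocks: the u_i are read as
-- they are, the complemented v_i negated.  Follow the position max B + 1 up
-- this chain.  For the D'-word w producing γ directly, min A and max B are its
-- first and last letters; inversion makes x̂ start with a 0 where w starts with
-- a 1, so w is read negated and max B + 1 lies just after w.  One level up, the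
-- letter after w in the enclosing word is a 1 (after a u_i, or before the next
-- factor of a concatenation in D) or a 0 (after a v_i); as w is read negated,
-- in both cases it is a 0 of x̂.  Hence max B + 1 is a 0 of y.  Every 0 of the
-- Dyck word y closes a factor 1u0 with u ∈ D, which makes it a matched 0.

{-# OPTIONS --safe #-}
module Submission where

open import Defs
open import Data.Bool using (Bool; true; false; not; _xor_)
open import Data.Bool.Properties using (not-involutive; not-distribˡ-xor; xor-identityʳ)
open import Data.Empty using (⊥-elim)
open import Data.Fin using (toℕ)
open import Data.Fin.Properties using (toℕ-fromℕ<; fromℕ<-cong)
open import Data.Integer using (ℤ; +_; -[1+_]; +≤+; _⊖_; _%ℕ_)
open import Data.Integer as ℤ using ()
open import Data.Integer.DivMod using (n%ℕd<d)
import Data.Integer.Properties as ℤP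
open import Algebra.Properties.AbelianGroup ℤP.+-0-abelianGroup using (∙-cancelˡ)
open import Data.List using (List; []; _∷_; _++_; length; map; take; drop; concat; concatMap)
open import Data.List.Properties
  using (∷-injective; ∷-injectiveˡ; ∷-injectiveʳ; ++-assoc; ++-identityʳ; length-++; length-map; map-++; concat-++; take++drop≡id)
open import Data.List.Membership.Propositional using (_∈_)
open import Data.List.Relation.Unary.All as All using (All; []; _∷_)
open import Data.List.Relation.Unary.Any using (here; there)
open import Data.Nat using (ℕ; zero; suc; NonZero; >-nonZero⁻¹; _≤_; _<_; _+_; _*_; _∸_; _%_; z≤n; s≤s)
import Data.Nat.Properties as ℕP
open import Data.Nat.DivMod using ([m+n]%n≡m%n; n%n≡0; m<n⇒m%n≡m; m≤n⇒[n∸m]%m≡n%m; %-distribˡ-+; m%n%n≡m%n)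
open import Data.Product using (∃; ∃₂; _×_; _,_)
open import Data.Sum using (_⊎_; inj₁; inj₂)
open import Data.Vec using (Vec; lookup)
open import Relation.Binary.Definitions using (tri<; tri≈; tri>)
open import Relation.Binary.PropositionalEquality
open import Relation.Nullary using (¬_)

++-split : ∀ {A : Set} (xs ys as bs : List A) → xs ++ ys ≡ as ++ bs →
  (∃ λ m → xs ≡ as ++ m × bs ≡ m ++ ys) ⊎ (∃₂ λ c m → as ≡ xs ++ c ∷ m × ys ≡ c ∷ m ++ bs)
++-split xs       ys []       bs e = inj₁ (xs , refl , sym e)
++-split []       ys (a ∷ as) bs e = inj₂ (a , as , refl , e)
++-split (x ∷ xs) ys (a ∷ as) bs e with ∷-injective e
... | refl , e′ with ++-split xs ys as bs e′
... | inj₁ (m , p , q)     = inj₁ (m , cong (x ∷_) p , q)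
... | inj₂ (c , m , p , q) = inj₂ (c , m , cong (x ∷_) p , q)

take-++ˡ : ∀ {A : Set} j (u r : List A) → j ≤ length u → take j (u ++ r) ≡ take j u
take-++ˡ zero    u       r _         = refl
take-++ˡ (suc j) (x ∷ u) r (s≤s j≤u) = cong (x ∷_) (take-++ˡ j u r j≤u)

concatMap-rotate : ∀ {A B : Set} (s : A) (g : B → A) bs R →
  concatMap (λ b → s ∷ g b ∷ []) bs ++ s ∷ R ≡ s ∷ concatMap (λ b → g b ∷ s ∷ []) bs ++ R
concatMap-rotate s g []       R = refl
concatMap-rotate s g (b ∷ bs) R = cong (λ t → s ∷ g b ∷ t) (concatMap-rotate s g bs R)

compl-involutive : ∀ w → compl (compl w) ≡ w
compl-involutive []      = refl
compl-involutive (c ∷ w) = cong₂ _∷_ (not-involutive c) (compl-involutive w)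

compl-split : ∀ {w} p c s → compl w ≡ p ++ c ∷ s → w ≡ compl p ++ not c ∷ compl s
compl-split {w} p c s e =
  trans (sym (compl-involutive w)) (trans (cong compl e) (map-++ not p (c ∷ s)))

i+[m+k]≡[i+m]+k : ∀ i m k → i ℤ.+ + (m + k) ≡ (i ℤ.+ + m) ℤ.+ + k
i+[m+k]≡[i+m]+k i m k = trans (cong (ℤ._+_ i) (ℤP.pos-+ m k)) (sym (ℤP.+-assoc i (+ m) (+ k)))

i+∣p++q∣ : ∀ {A : Set} i (p q : List A) → i ℤ.+ + length (p ++ q) ≡ (i ℤ.+ + length p) ℤ.+ + length q
i+∣p++q∣ i p q = trans (cong (λ t → i ℤ.+ + t) (length-++ p)) (i+[m+k]≡[i+m]+k i (length p) (length q))

bal-++ : ∀ a b → bal (a ++ b) ≡ bal a ℤ.+ bal b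
bal-++ []          b = sym (ℤP.+-identityˡ (bal b))
bal-++ (true ∷ a)  b = trans (cong (ℤ._+_ (+ 1)) (bal-++ a b)) (sym (ℤP.+-assoc (+ 1) (bal a) (bal b)))
bal-++ (false ∷ a) b = trans (cong (ℤ._+_ (ℤ.- + 1)) (bal-++ a b)) (sym (ℤP.+-assoc (ℤ.- + 1) (bal a) (bal b)))

elevate : List Bool → List Bool
elevate u = true ∷ u ++ false ∷ []

bal-1u0r≡bal-r : ∀ u → Balanced u → ∀ r → bal (true ∷ u ++ false ∷ r) ≡ bal r
bal-1u0r≡bal-r u bu r = begin
  + 1 ℤ.+ bal (u ++ false ∷ r)                  ≡⟨ cong (ℤ._+_ (+ 1)) (bal-++ u (false ∷ r)) ⟩
  + 1 ℤ.+ (bal u ℤ.+ (ℤ.- + 1 ℤ.+ bal r))       ≡⟨ cong (λ z → + 1 ℤ.+ (z ℤ.+ (ℤ.- + 1 ℤ.+ bal r))) bu ⟩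
  + 1 ℤ.+ (+ 0 ℤ.+ (ℤ.- + 1 ℤ.+ bal r))         ≡⟨ cong (ℤ._+_ (+ 1)) (ℤP.+-identityˡ (ℤ.- + 1 ℤ.+ bal r)) ⟩
  + 1 ℤ.+ (ℤ.- + 1 ℤ.+ bal r)                   ≡⟨ ℤP.+-assoc (+ 1) (ℤ.- + 1) (bal r) ⟨
  + 0 ℤ.+ bal r                                 ≡⟨ ℤP.+-identityˡ (bal r) ⟩
  bal r                                         ∎
  where open ≡-Reasoning

Dyck⇒Balanced : ∀ {w} → Dyck w → Balanced w
Dyck⇒Balanced ε                   = refl
Dyck⇒Balanced (cat {u} {v} du dv) = trans (bal-1u0r≡bal-r u (Dyck⇒Balanced du) v) (Dyck⇒Balanced dv)

Dyck-head : ∀ {c w} → Dyck (c ∷ w) → c ≡ true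
Dyck-head (cat _ _) = refl

Dyck⇒prefix-bal≥0 : ∀ {w} → Dyck w → ∀ a b → w ≡ a ++ b → + 0 ℤ.≤ bal a
Dyck⇒prefix-bal≥0 _   []          b _  = ℤP.≤-refl
Dyck⇒prefix-bal≥0 ε   (_ ∷ _)     b ()
Dyck⇒prefix-bal≥0 (cat _ _) (false ∷ _) b ()
Dyck⇒prefix-bal≥0 (cat {u} {v} du dv) (true ∷ a) b e
  with ++-split u (false ∷ v) a b (∷-injectiveʳ e)
... | inj₁ (m , u≡a++m , _) =
  ℤP.≤-trans (Dyck⇒prefix-bal≥0 du a m u≡a++m) (ℤP.i≤suc[i] (bal a))
... | inj₂ (_ , m , refl , e′) with ∷-injective e′
... | refl , v≡m++b =
  subst (+ 0 ℤ.≤_) (sym (bal-1u0r≡bal-r u (Dyck⇒Balanced du) m)) (Dyck⇒prefix-bal≥0 dv m b v≡m++b)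

elevate-balanced : ∀ {u} → Dyck u → Balanced (elevate u)
elevate-balanced {u} du = bal-1u0r≡bal-r u (Dyck⇒Balanced du) []

elevate-no-balanced-prefix : ∀ {u} → Dyck u → ∀ j → 1 ≤ j → j < 2 + length u →
  ¬ Balanced (take j (elevate u))
elevate-no-balanced-prefix {u} du (suc j) _ (s≤s (s≤s j≤u))
  rewrite take-++ˡ j u (false ∷ []) j≤u =
  1+nonneg≢0 (Dyck⇒prefix-bal≥0 du (take j u) (drop j u) (sym (take++drop≡id j u)))
  where
  1+nonneg≢0 : ∀ {t} → + 0 ℤ.≤ t → + 1 ℤ.+ t ≢ + 0
  1+nonneg≢0 (+≤+ z≤n) ()

Dyck-zero-closes : ∀ {w} → Dyck w → ∀ p s → w ≡ p ++ false ∷ s →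
  ∃₂ λ q u → Dyck u × p ≡ q ++ true ∷ u
Dyck-zero-closes ε         []          _ ()
Dyck-zero-closes ε         (_ ∷ _)     _ ()
Dyck-zero-closes (cat _ _) []          _ ()
Dyck-zero-closes (cat _ _) (false ∷ _) _ ()
Dyck-zero-closes (cat {u} {v} du dv) (true ∷ p) s e
  with ++-split u (false ∷ v) p (false ∷ s) (∷-injectiveʳ e)
... | inj₁ ([] , u≡p++[] , _) =
  [] , u , du , cong (true ∷_) (sym (trans u≡p++[] (++-identityʳ p)))
... | inj₁ (c ∷ m , u≡p++cm , e′) with ∷-injective e′
... | refl , _ with Dyck-zero-closes du p m u≡p++cm
... | q , u′ , du′ , p≡ = true ∷ q , u′ , du′ , cong (true ∷_) p≡
Dyck-zero-closes (cat {u} {v} du dv) (true ∷ p) s e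
  | inj₂ (c , m , p≡u++cm , e′) with ∷-injective e′
... | refl , v≡m++0s with Dyck-zero-closes dv m s v≡m++0s
... | q , u′ , du′ , m≡ = true ∷ u ++ false ∷ q , u′ , du′ , cong (true ∷_) p≡
  where
  p≡ : p ≡ (u ++ false ∷ q) ++ true ∷ u′
  p≡ = trans p≡u++cm (trans (cong (λ t → u ++ false ∷ t) m≡) (sym (++-assoc u (false ∷ q) (true ∷ u′))))

module _ (f : ℤ → Bool) where

  sub-lookup : ∀ a L p c s → sub f a L ≡ p ++ c ∷ s → c ≡ f (a ℤ.+ + length p)
  sub-lookup a zero    []      c s ()
  sub-lookup a zero    (_ ∷ _) c s ()
  sub-lookup a (suc L) []      c s e = trans (sym (∷-injectiveˡ e)) (cong f (sym (ℤP.+-identityʳ a)))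
  sub-lookup a (suc L) (_ ∷ p) c s e =
    trans (sub-lookup (a ℤ.+ + 1) L p c s (∷-injectiveʳ e)) (cong f (sym (i+[m+k]≡[i+m]+k a 1 (length p))))

  sub-prefix : ∀ a L z s → sub f a L ≡ z ++ s → sub f a (length z) ≡ z
  sub-prefix a L       []      s e = refl
  sub-prefix a zero    (_ ∷ _) s ()
  sub-prefix a (suc L) (c ∷ z) s e =
    cong₂ _∷_ (∷-injectiveˡ e) (sub-prefix (a ℤ.+ + 1) L z s (∷-injectiveʳ e))

  sub-infix : ∀ a L q z s → sub f a L ≡ q ++ z ++ s → sub f (a ℤ.+ + length q) (length z) ≡ z
  sub-infix a L       []      z s e = trans (cong (λ b → sub f b (length z)) (ℤP.+-identityʳ a)) (sub-prefix a L z s e)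
  sub-infix a zero    (_ ∷ _) z s ()
  sub-infix a (suc L) (_ ∷ q) z s e =
    trans (cong (λ b → sub f b (length z)) (i+[m+k]≡[i+m]+k a 1 (length q)))
          (sub-infix (a ℤ.+ + 1) L q z s (∷-injectiveʳ e))

  take-sub : ∀ a L′ L → L′ ≤ L → take L′ (sub f a L) ≡ sub f a L′
  take-sub a zero     L       _          = refl
  take-sub a (suc L′) (suc L) (s≤s L′≤L) = cong (f a ∷_) (take-sub (a ℤ.+ + 1) L′ L L′≤L)

  sub-cong : ∀ b c → (∀ k → f (b ℤ.+ + k) ≡ f (c ℤ.+ + k)) → ∀ m → sub f b m ≡ sub f c m
  sub-cong b c same zero    = refl
  sub-cong b c same (suc m) =
    cong₂ _∷_ (trans (cong f (sym (ℤP.+-identityʳ b))) (trans (same 0) (cong f (ℤP.+-identityʳ c))))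
      (sub-cong (b ℤ.+ + 1) (c ℤ.+ + 1) shifted m)
    where
    shifted : ∀ k → f ((b ℤ.+ + 1) ℤ.+ + k) ≡ f ((c ℤ.+ + 1) ℤ.+ + k)
    shifted k = trans (cong f (sym (i+[m+k]≡[i+m]+k b 1 k)))
                  (trans (same (suc k)) (cong f (i+[m+k]≡[i+m]+k c 1 k)))

module _ (n : ℕ) .{{_ : NonZero n}} where

  private
    neg% : ℕ → ℕ
    neg% zero    = 0
    neg% (suc r) = n ∸ suc r

    -[1+m]%ℕn : ∀ m → -[1+ m ] %ℕ n ≡ neg% (suc m % n)
    -[1+m]%ℕn m with suc m % n
    ... | zero  = refl
    ... | suc r = refl

  [i+n]%ℕn≡i%ℕn : ∀ i → (i ℤ.+ + n) %ℕ n ≡ i %ℕ n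
  [i+n]%ℕn≡i%ℕn (+ m)     = [m+n]%n≡m%n m n
  [i+n]%ℕn≡i%ℕn -[1+ m ] with ℕP.<-cmp (suc m) n
  ... | tri< m<n _ _ = begin
    (n ⊖ suc m) %ℕ n   ≡⟨ cong (_%ℕ n) (ℤP.⊖-≥ (ℕP.<⇒≤ m<n)) ⟩
    (n ∸ suc m) % n    ≡⟨ m<n⇒m%n≡m (ℕP.∸-monoʳ-< (s≤s z≤n) (ℕP.<⇒≤ m<n)) ⟩
    neg% (suc m)       ≡⟨ cong neg% (m<n⇒m%n≡m m<n) ⟨
    neg% (suc m % n)   ≡⟨ -[1+m]%ℕn m ⟨
    -[1+ m ] %ℕ n      ∎
    where open ≡-Reasoning
  ... | tri≈ _ m≡n _ = begin
    (n ⊖ suc m) %ℕ n   ≡⟨ cong (_%ℕ n) (trans (cong (n ⊖_) m≡n) (ℤP.n⊖n≡0 n)) ⟩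
    0 % n              ≡⟨ m<n⇒m%n≡m (>-nonZero⁻¹ n) ⟩
    neg% 0             ≡⟨ cong neg% (trans (cong (_% n) m≡n) (n%n≡0 n)) ⟨
    neg% (suc m % n)   ≡⟨ -[1+m]%ℕn m ⟨
    -[1+ m ] %ℕ n      ∎
    where open ≡-Reasoning
  ... | tri> _ _ n<m = begin
    (n ⊖ suc m) %ℕ n         ≡⟨ cong (_%ℕ n) (ℤP.⊖-< n<m) ⟩
    (ℤ.- + (suc m ∸ n)) %ℕ n ≡⟨ cong (λ k → (ℤ.- + k) %ℕ n) (ℕP.+-∸-assoc 1 (ℕP.≤-pred n<m)) ⟩
    -[1+ m ∸ n ] %ℕ n        ≡⟨ -[1+m]%ℕn (m ∸ n) ⟩
    neg% (suc (m ∸ n) % n)   ≡⟨ cong (λ k → neg% (k % n)) (ℕP.+-∸-assoc 1 (ℕP.≤-pred n<m)) ⟨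
    neg% ((suc m ∸ n) % n)   ≡⟨ cong neg% (m≤n⇒[n∸m]%m≡n%m (ℕP.<⇒≤ n<m)) ⟩
    neg% (suc m % n)         ≡⟨ -[1+m]%ℕn m ⟨
    -[1+ m ] %ℕ n            ∎
    where open ≡-Reasoning

  [i+cn]%ℕn≡i%ℕn : ∀ c i → (i ℤ.+ + (c * n)) %ℕ n ≡ i %ℕ n
  [i+cn]%ℕn≡i%ℕn zero    i = cong (_%ℕ n) (ℤP.+-identityʳ i)
  [i+cn]%ℕn≡i%ℕn (suc c) i =
    trans (cong (_%ℕ n) (i+[m+k]≡[i+m]+k i n (c * n)))
          (trans ([i+cn]%ℕn≡i%ℕn c (i ℤ.+ + n)) ([i+n]%ℕn≡i%ℕn i))

  shift-to-ℕ : ∀ i → ∃₂ λ c m → i ℤ.+ + (c * n) ≡ + m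
  shift-to-ℕ (+ m)     = 0 , m , cong +_ (ℕP.+-identityʳ m)
  shift-to-ℕ -[1+ m ] = suc m , _ , ℤP.⊖-≥ (ℕP.m≤m*n (suc m) n)

  [i%ℕn+k]%ℕn≡[i+k]%ℕn : ∀ i k → (+ (i %ℕ n) ℤ.+ + k) %ℕ n ≡ (i ℤ.+ + k) %ℕ n
  [i%ℕn+k]%ℕn≡[i+k]%ℕn i k with shift-to-ℕ i
  ... | c , m , i+cn≡m = begin
    (i %ℕ n + k) % n               ≡⟨ cong (λ t → (t + k) % n) i%n≡m%n ⟩
    (m % n + k) % n                ≡⟨ %-distribˡ-+ (m % n) k n ⟩
    (m % n % n + k % n) % n        ≡⟨ cong (λ t → (t + k % n) % n) (m%n%n≡m%n m n) ⟩
    (m % n + k % n) % n            ≡⟨ %-distribˡ-+ m k n ⟨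
    (m + k) % n                    ≡⟨ cong (_%ℕ n) i+k+cn≡m+k ⟨
    ((i ℤ.+ + k) ℤ.+ + (c * n)) %ℕ n ≡⟨ [i+cn]%ℕn≡i%ℕn c (i ℤ.+ + k) ⟩
    (i ℤ.+ + k) %ℕ n               ∎
    where
    open ≡-Reasoning
    i%n≡m%n : i %ℕ n ≡ m % n
    i%n≡m%n = trans (sym ([i+cn]%ℕn≡i%ℕn c i)) (cong (_%ℕ n) i+cn≡m)
    i+k+cn≡m+k : (i ℤ.+ + k) ℤ.+ + (c * n) ≡ + (m + k)
    i+k+cn≡m+k = begin
      (i ℤ.+ + k) ℤ.+ + (c * n)  ≡⟨ ℤP.+-assoc i (+ k) _ ⟩
      i ℤ.+ (+ k ℤ.+ + (c * n))  ≡⟨ cong (ℤ._+_ i) (ℤP.+-comm (+ k) (+ (c * n))) ⟩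
      i ℤ.+ (+ (c * n) ℤ.+ + k)  ≡⟨ ℤP.+-assoc i (+ (c * n)) (+ k) ⟨
      (i ℤ.+ + (c * n)) ℤ.+ + k  ≡⟨ cong (ℤ._+ + k) i+cn≡m ⟩
      + (m + k)                  ∎

  modFin-shift : ∀ i k → modFin n (+ toℕ (modFin n i) ℤ.+ + k) ≡ modFin n (i ℤ.+ + k)
  modFin-shift i k = fromℕ<-cong _ _
    (trans (cong (λ t → (+ t ℤ.+ + k) %ℕ n) (toℕ-fromℕ< (n%ℕd<d i n))) ([i%ℕn+k]%ℕn≡[i+k]%ℕn i k)) _ _

-- Decomposition of the words of D'

data Separated : List Seg → Set where
  []     : Separated []
  oneA∷  : ∀ {ss} → Separated ss → Separated (oneA ∷ ss)
  zeroB∷ : ∀ {ss} → Separated ss → Separated (zeroB ∷ ss)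
  hill∷  : ∀ {u ss} → Separated ss → Separated (blkU u ∷ oneA ∷ ss)
  valley∷ : ∀ {v ss} → Separated ss → Separated (blkV v ∷ zeroB ∷ ss)

layout-shape : ∀ us v0 vs →
  layout us v0 vs ≡ oneA ∷ concatMap (λ u → blkU u ∷ oneA ∷ []) us
                       ++ oneA ∷ concatMap (λ v → blkV v ∷ zeroB ∷ []) (v0 ∷ vs) ++ zeroB ∷ []
layout-shape us v0 vs =
  trans (concatMap-rotate oneA blkU us _)
        (cong (λ t → oneA ∷ concatMap (λ u → blkU u ∷ oneA ∷ []) us ++ oneA ∷ blkV v0 ∷ t)
              (concatMap-rotate zeroB blkV vs (zeroB ∷ [])))

Decomp-shape : ∀ {y ss} → Decomp y ss →
  Separated ss × (∃ λ mid → ss ≡ oneA ∷ mid ++ zeroB ∷ []) × y ≡ flatten ss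
Decomp-shape (h1 y≡) = oneA∷ (zeroB∷ []) , ([] , refl) , y≡
Decomp-shape (h≥2 us v0 vs _ _ _ _ y≡) =
  subst Separated (sym (layout-shape us v0 vs)) (oneA∷ (hills us (oneA∷ (valleys (v0 ∷ vs) (zeroB∷ []))))) ,
  (concatMap U us ++ oneA ∷ concatMap V (v0 ∷ vs) ,
   trans (layout-shape us v0 vs)
         (cong (oneA ∷_) (sym (++-assoc (concatMap U us) (oneA ∷ concatMap V (v0 ∷ vs)) (zeroB ∷ []))))) ,
  y≡
  where
  U V : List Bool → List Seg
  U u = blkU u ∷ oneA ∷ []
  V v = blkV v ∷ zeroB ∷ []
  hills : ∀ us {R} → Separated R → Separated (concatMap U us ++ R)
  hills []       sep = sep
  hills (_ ∷ us) sep = hill∷ (hills us sep)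
  valleys : ∀ vs {R} → Separated R → Separated (concatMap V vs ++ R)
  valleys []       sep = sep
  valleys (_ ∷ vs) sep = valley∷ (valleys vs sep)

flatten-++ : ∀ ss ts → flatten (ss ++ ts) ≡ flatten ss ++ flatten ts
flatten-++ ss ts = trans (cong concat (map-++ segWord ss ts)) (sym (concat-++ (map segWord ss) (map segWord ts)))

posA-lower : ∀ a ss → All (a ℤ.≤_) (posA a ss)
posA-lower a [] = []
posA-lower a (oneA ∷ ss) = ℤP.≤-refl ∷ All.map (ℤP.≤-trans (ℤP.i≤i+j a (+ 1))) (posA-lower (a ℤ.+ + 1) ss)
posA-lower a (zeroB ∷ ss) = All.map (ℤP.≤-trans (ℤP.i≤i+j a (+ 1))) (posA-lower (a ℤ.+ + 1) ss)
posA-lower a (blkU u ∷ ss) = All.map (ℤP.≤-trans (ℤP.i≤i+j a (+ length u))) (posA-lower _ ss)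
posA-lower a (blkV v ∷ ss) = All.map (ℤP.≤-trans (ℤP.i≤i+j a (+ length v))) (posA-lower _ ss)

posB-upper-moved : ∀ a w ss {B} →
  All (λ z → z ℤ.+ + 1 ℤ.≤ (a ℤ.+ + length w) ℤ.+ + length (flatten ss)) B →
  All (λ z → z ℤ.+ + 1 ℤ.≤ a ℤ.+ + length (w ++ flatten ss)) B
posB-upper-moved a w ss = All.map (λ le → ℤP.≤-trans le (ℤP.≤-reflexive (sym (i+∣p++q∣ a w (flatten ss)))))

posB-upper : ∀ a ss → All (λ z → z ℤ.+ + 1 ℤ.≤ a ℤ.+ + length (flatten ss)) (posB a ss)
posB-upper a []            = []
posB-upper a (zeroB ∷ ss)  =
  ℤP.≤-trans (ℤP.i≤i+j (a ℤ.+ + 1) (+ length (flatten ss))) (ℤP.≤-reflexive (sym (i+∣p++q∣ a (false ∷ []) (flatten ss))))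
  ∷ posB-upper-moved a (false ∷ []) ss (posB-upper (a ℤ.+ + 1) ss)
posB-upper a (oneA ∷ ss)   = posB-upper-moved a (true ∷ []) ss (posB-upper (a ℤ.+ + 1) ss)
posB-upper a (blkU u ∷ ss) = posB-upper-moved a u ss (posB-upper (a ℤ.+ + length u) ss)
posB-upper a (blkV v ∷ ss) = posB-upper-moved a v ss (posB-upper (a ℤ.+ + length v) ss)

posB-last-moved : ∀ a w ss {B} → (a ℤ.+ + length w) ℤ.+ + length (flatten ss) ∈ B →
  a ℤ.+ + length (w ++ flatten ss) ∈ B
posB-last-moved a w ss = subst (_∈ _) (sym (i+∣p++q∣ a w (flatten ss)))

posB-last : ∀ a ss → a ℤ.+ + length (flatten ss) ∈ posB a (ss ++ zeroB ∷ [])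
posB-last a [] = here (ℤP.+-identityʳ a)
posB-last a (zeroB ∷ ss)  = there (posB-last-moved a (false ∷ []) ss (posB-last (a ℤ.+ + 1) ss))
posB-last a (oneA ∷ ss)   = posB-last-moved a (true ∷ []) ss (posB-last (a ℤ.+ + 1) ss)
posB-last a (blkU u ∷ ss) = posB-last-moved a u ss (posB-last (a ℤ.+ + length u) ss)
posB-last a (blkV v ∷ ss) = posB-last-moved a v ss (posB-last (a ℤ.+ + length v) ss)

min-posA : ∀ a ss → IsMin a (posA a (oneA ∷ ss))
min-posA a ss = here refl , posA-lower a (oneA ∷ ss)

max-posB : ∀ {hi} a ss → IsMax hi (posB a (ss ++ zeroB ∷ [])) →
  a ℤ.+ + length (flatten (ss ++ zeroB ∷ [])) ≡ hi ℤ.+ + 1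
max-posB {hi} a ss (hi∈B , ≤hi) = ℤP.≤-antisym end≤ (All.lookup (posB-upper a (ss ++ zeroB ∷ [])) hi∈B)
  where
  end≡ : a ℤ.+ + length (flatten (ss ++ zeroB ∷ [])) ≡ (a ℤ.+ + length (flatten ss)) ℤ.+ + 1
  end≡ = trans (cong (λ t → a ℤ.+ + length t) (flatten-++ ss (zeroB ∷ []))) (i+∣p++q∣ a (flatten ss) (false ∷ []))
  end≤ : a ℤ.+ + length (flatten (ss ++ zeroB ∷ [])) ℤ.≤ hi ℤ.+ + 1
  end≤ = subst (ℤ._≤ hi ℤ.+ + 1) (sym end≡) (ℤP.+-monoˡ-≤ (+ 1) (All.lookup ≤hi (posB-last a ss)))

data Block (a : ℤ) (y : List Bool) (b : ℤ) : List Bool → Set where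
  hill   : ∀ P u S → y ≡ P ++ u ++ true ∷ S → b ≡ a ℤ.+ + length P → Block a y b u
  valley : ∀ P v S → y ≡ P ++ v ++ false ∷ S → b ≡ a ℤ.+ + length P → Block a y b (compl v)

Block-prepend : ∀ {a y b w} W → Block (a ℤ.+ + length W) y b w → Block a (W ++ y) b w
Block-prepend {a} W (hill P u S y≡ b≡) =
  hill (W ++ P) u S (trans (cong (W ++_) y≡) (sym (++-assoc W P _))) (trans b≡ (sym (i+∣p++q∣ a W P)))
Block-prepend {a} W (valley P v S y≡ b≡) =
  valley (W ++ P) v S (trans (cong (W ++_) y≡) (sym (++-assoc W P _))) (trans b≡ (sym (i+∣p++q∣ a W P)))

block-split : ∀ {a ss b w} → Separated ss → (b , w) ∈ blocks a ss → Block a (flatten ss) b w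
block-split (oneA∷ sep)  b∈ = Block-prepend (true ∷ []) (block-split sep b∈)
block-split (zeroB∷ sep) b∈ = Block-prepend (false ∷ []) (block-split sep b∈)
block-split {a} (hill∷ {u} {ss} sep) (here refl) =
  hill [] u (flatten ss) refl (sym (ℤP.+-identityʳ a))
block-split (hill∷ {u} sep) (there b∈) = Block-prepend u (block-split (oneA∷ sep) b∈)
block-split {a} (valley∷ {v} {ss} sep) (here refl) =
  valley [] v (flatten ss) refl (sym (ℤP.+-identityʳ a))
block-split (valley∷ {v} sep) (there b∈) = Block-prepend v (block-split (zeroB∷ sep) b∈)

-- The position after an inverted glider

module _ {n : ℕ} .{{_ : NonZero n}} (x : Vec Bool n) where

  record Reads (o : Bool) (b : ℤ) (w : List Bool) : Set where
    constructor reads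
    field letter : ∀ p c s → w ≡ p ++ c ∷ s → c ≡ o xor xhat x (b ℤ.+ + length p)
  open Reads

  sub-Reads : ∀ a L → Reads false a (sub (xhat x) a L)
  sub-Reads a L = reads (sub-lookup (xhat x) a L)

  Reads-prefix : ∀ {o b} w r → Reads o b (w ++ r) → Reads o b w
  Reads-prefix w r rd = reads λ p c s w≡ → letter rd p c (s ++ r) (trans (cong (_++ r) w≡) (++-assoc p (c ∷ s) r))

  Reads-suffix : ∀ {o b} P w → Reads o b (P ++ w) → Reads o (b ℤ.+ + length P) w
  Reads-suffix {o} {b} P w rd = reads λ p c s w≡ →
    trans (letter rd (P ++ p) c s (trans (cong (P ++_) w≡) (sym (++-assoc P p (c ∷ s)))))
          (cong (λ i → o xor xhat x i) (i+∣p++q∣ b P p))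

  Reads-compl : ∀ {o b} w → Reads o b w → Reads (not o) b (compl w)
  Reads-compl {o} {b} w rd = reads λ p c s w≡ → begin
    c                                              ≡⟨ not-involutive c ⟨
    not (not c)                                    ≡⟨ cong not (letter rd (compl p) (not c) (compl s) (compl-split p c s w≡)) ⟩
    not (o xor xhat x (b ℤ.+ + length (compl p)))  ≡⟨ not-distribˡ-xor o _ ⟩
    not o xor xhat x (b ℤ.+ + length (compl p))    ≡⟨ cong (λ k → not o xor xhat x (b ℤ.+ + k)) (length-map not p) ⟩
    not o xor xhat x (b ℤ.+ + length p)            ∎
    where open ≡-Reasoning

  data ZeroInside (b : ℤ) (w : List Bool) (j : ℤ) : Set where
    at : ∀ p c s → w ≡ p ++ c ∷ s → b ℤ.+ + length p ≡ j → xhat x j ≡ false → ZeroInside b w j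

  -- The possible places of the position j after an inverted glider of w.
  data StepAfter (b : ℤ) (w : List Bool) (j : ℤ) : Bool → Set where
    inside : ∀ {o} → ZeroInside b w j → StepAfter b w j o
    atEnd  : b ℤ.+ + length w ≡ j → StepAfter b w j true

  ZeroInside-++ʳ : ∀ {b w j} r → ZeroInside b w j → ZeroInside b (w ++ r) j
  ZeroInside-++ʳ r (at p c s w≡ pos x̂j≡0) =
    at p c (s ++ r) (trans (cong (_++ r) w≡) (++-assoc p (c ∷ s) r)) pos x̂j≡0

  ZeroInside-++ˡ : ∀ {b w j} P → ZeroInside (b ℤ.+ + length P) w j → ZeroInside b (P ++ w) j
  ZeroInside-++ˡ {b} P (at p c s w≡ pos x̂j≡0) =
    at (P ++ p) c s (trans (cong (P ++_) w≡) (sym (++-assoc P p (c ∷ s)))) (trans (i+∣p++q∣ b P p) pos) x̂j≡0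

  ZeroInside-uncompl : ∀ {b w j} → ZeroInside b (compl w) j → ZeroInside b w j
  ZeroInside-uncompl {b} (at p c s w≡ pos x̂j≡0) =
    at (compl p) (not c) (compl s) (compl-split p c s w≡)
       (trans (cong (λ k → b ℤ.+ + k) (length-map not p)) pos) x̂j≡0

  StepAfter-++ˡ : ∀ {b w j o} P → StepAfter (b ℤ.+ + length P) w j o → StepAfter b (P ++ w) j o
  StepAfter-++ˡ         P (inside i)  = inside (ZeroInside-++ˡ P i)
  StepAfter-++ˡ {b} {w} P (atEnd end) = atEnd (trans (i+∣p++q∣ b P w) end)

  StepAfter-then-1 : ∀ {b w j o} r → Reads o b (w ++ true ∷ r) → StepAfter b w j o →
    ZeroInside b (w ++ true ∷ r) j
  StepAfter-then-1         r rd (inside i)  = ZeroInside-++ʳ (true ∷ r) i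
  StepAfter-then-1 {b} {w} r rd (atEnd end) =
    at w true r refl end (trans (cong (xhat x) (sym end)) (trans (sym (not-involutive _)) (cong not (sym (letter rd w true r refl)))))

  StepAfter-compl-then-0 : ∀ {b v j o} r → Reads o b (v ++ false ∷ r) → StepAfter b (compl v) j (not o) →
    ZeroInside b (v ++ false ∷ r) j
  StepAfter-compl-then-0 {o = true}  r rd (inside i) = ZeroInside-++ʳ (false ∷ r) (ZeroInside-uncompl i)
  StepAfter-compl-then-0 {o = false} r rd (inside i) = ZeroInside-++ʳ (false ∷ r) (ZeroInside-uncompl i)
  StepAfter-compl-then-0 {b} {v} {j} {false} r rd (atEnd end) =
    at v false r refl pos (trans (cong (xhat x) (sym pos)) (sym (letter rd v false r refl)))
    where
    pos : b ℤ.+ + length v ≡ j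
    pos = trans (cong (λ k → b ℤ.+ + k) (sym (length-map not v))) end

  StepAfter-++-Dyck : ∀ {b w r j o} → Reads o b (w ++ r) → Dyck r → StepAfter b w j o → StepAfter b (w ++ r) j o
  StepAfter-++-Dyck {b} {w} {j = j} {o} rd ε st = subst (λ w′ → StepAfter b w′ j o) (sym (++-identityʳ w)) st
  StepAfter-++-Dyck rd (cat {u} {v} _ _) st = inside (StepAfter-then-1 (u ++ false ∷ v) rd st)

  Block-step : ∀ {a y b w o j} → Block a y b w → Reads o a y →
    (∀ {o′} → Reads o′ b w → StepAfter b w j o′) → StepAfter a y j o
  Block-step {a} {o = o} (hill P u S refl refl) rd step =
    inside (ZeroInside-++ˡ P (StepAfter-then-1 S rdᵤ (step (Reads-prefix u (true ∷ S) rdᵤ))))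
    where
    rdᵤ : Reads o (a ℤ.+ + length P) (u ++ true ∷ S)
    rdᵤ = Reads-suffix P (u ++ true ∷ S) rd
  Block-step {a} {o = o} (valley P v S refl refl) rd step =
    inside (ZeroInside-++ˡ P (StepAfter-compl-then-0 S rdᵥ (step (Reads-compl v (Reads-prefix v (false ∷ S) rdᵥ)))))
    where
    rdᵥ : Reads o (a ℤ.+ + length P) (v ++ false ∷ S)
    rdᵥ = Reads-suffix P (v ++ false ∷ S) rd

  valley-starts-with-0 : ∀ {lo hi} m → ValleyOn x lo hi → lo ℤ.+ + suc m ≡ hi ℤ.+ + 1 → xhat x lo ≡ false
  valley-starts-with-0 {lo} m (L , lo+L≡ , dyck) end
    with ℤP.+-injective (∙-cancelˡ lo (+ L) (+ suc m) (trans lo+L≡ (sym end)))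
  ... | refl = trans (sym (not-involutive _)) (cong not (Dyck-head dyck))

  top-glider-after : ∀ {b w ss o hi} → Decomp w ss → Reads o b w →
    Inverted x (posA b ss , posB b ss) → IsMax hi (posB b ss) → StepAfter b w (hi ℤ.+ + 1) o
  top-glider-after {b} {o = o} {hi} dc rd inv hi-max with Decomp-shape dc
  ... | _ , (mid , refl) , refl = subst (StepAfter b _ (hi ℤ.+ + 1)) (sym o≡true) (atEnd end)
    where
    end : b ℤ.+ + length (flatten (oneA ∷ mid ++ zeroB ∷ [])) ≡ hi ℤ.+ + 1
    end = max-posB b (oneA ∷ mid) hi-max
    x̂b≡0 : xhat x b ≡ false
    x̂b≡0 = valley-starts-with-0 {hi = hi} (length (flatten (mid ++ zeroB ∷ []))) (inv b hi (min-posA b (mid ++ zeroB ∷ [])) hi-max) end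
    o≡true : o ≡ true
    o≡true = sym (trans (letter rd [] true _ refl)
                 (trans (cong (λ i → o xor xhat x i) (ℤP.+-identityʳ b)) (trans (cong (o xor_) x̂b≡0) (xor-identityʳ o))))

  mutual
    GamD-step : ∀ {b w A B o hi} → GamD b w (A , B) → Reads o b w →
      Inverted x (A , B) → IsMax hi B → StepAfter b w (hi ℤ.+ + 1) o
    GamD-step (here {p} {r} _ dr γ)  rd inv hi-max =
      StepAfter-++-Dyck rd dr (GamP-step γ (Reads-prefix p r rd) inv hi-max)
    GamD-step (there {p} {r} _ _ γ) rd inv hi-max =
      StepAfter-++ˡ p (GamD-step γ (Reads-suffix p r rd) inv hi-max)

    GamP-step : ∀ {b w A B o hi} → GamP b w (A , B) → Reads o b w →
      Inverted x (A , B) → IsMax hi B → StepAfter b w (hi ℤ.+ + 1) o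
    GamP-step (top _ dc) rd inv hi-max = top-glider-after dc rd inv hi-max
    GamP-step (rec _ dc b∈ γ) rd inv hi-max with Decomp-shape dc
    ... | sep , _ , refl = Block-step (block-split sep b∈) rd (λ rd′ → GamD-step γ rd′ inv hi-max)

-- Matched zeros

length-elevate : ∀ u → length (elevate u) ≡ 2 + length u
length-elevate u = cong suc (trans (length-++ u) (ℕP.+-comm (length u) 1))

elevate-matched : ∀ {n} .{{_ : NonZero n}} (x : Vec Bool n) i {u} → Dyck u →
  sub (xhat x) i (2 + length u) ≡ elevate u → MatchedZeroHat x (i ℤ.+ + suc (length u))
elevate-matched {n} x i {u} du sub≡ =
  x̂≡0 , modFin n i , 2 + length u , suc (length u) , x̂i≡1 , (s≤s z≤n , balanced , shortest) ,
  ℕP.≤-refl , trans (cong (lookup x) (modFin-shift n i (suc (length u)))) x̂≡0 ,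
  (λ t′ t<t′ t′<L → ⊥-elim (ℕP.<⇒≱ t<t′ (ℕP.≤-pred t′<L))) ,
  modFin-shift n i (suc (length u))
  where
  f : ℤ → Bool
  f = xhat x
  i′ : ℤ
  i′ = + toℕ (modFin n i)
  periodic : ∀ m → sub f i′ m ≡ sub f i m
  periodic = sub-cong f i′ i (λ k → cong (lookup x) (modFin-shift n i k))
  x̂≡0 : f (i ℤ.+ + suc (length u)) ≡ false
  x̂≡0 = sym (sub-lookup f i _ (true ∷ u) false [] sub≡)
  x̂i≡1 : lookup x (modFin n i) ≡ true
  x̂i≡1 = sym (trans (sub-lookup f i _ [] true (u ++ false ∷ []) sub≡) (cong f (ℤP.+-identityʳ i)))
  balanced : Balanced (sub f i′ (2 + length u))
  balanced = trans (cong bal (trans (periodic _) sub≡)) (elevate-balanced du)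
  shortest : ∀ L′ → 1 ≤ L′ → L′ < 2 + length u → ¬ Balanced (sub f i′ L′)
  shortest L′ 1≤L′ L′<L bal≡0 = elevate-no-balanced-prefix du L′ 1≤L′ L′<L (subst Balanced prefix≡ bal≡0)
    where
    prefix≡ : sub f i′ L′ ≡ take L′ (elevate u)
    prefix≡ = trans (periodic L′) (trans (sym (take-sub f i L′ _ (ℕP.<⇒≤ L′<L))) (cong (take L′) sub≡))

Dyck-subword-zero-matched : ∀ {n} .{{_ : NonZero n}} (x : Vec Bool n) a L p s →
  Dyck (sub (xhat x) a L) → sub (xhat x) a L ≡ p ++ false ∷ s → MatchedZeroHat x (a ℤ.+ + length p)
Dyck-subword-zero-matched x a L p s dy y≡ with Dyck-zero-closes dy p s y≡
... | q , u , du , refl =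
  subst (MatchedZeroHat x) (sym (i+∣p++q∣ a q (true ∷ u))) (elevate-matched x (a ℤ.+ + length q) du factor)
  where
  y≡′ : sub (xhat x) a L ≡ q ++ elevate u ++ s
  y≡′ = trans y≡ (trans (++-assoc q (true ∷ u) (false ∷ s)) (cong (λ t → q ++ true ∷ t) (sym (++-assoc u (false ∷ []) s))))
  factor : sub (xhat x) (a ℤ.+ + length q) (2 + length u) ≡ elevate u
  factor = subst (λ m → sub (xhat x) (a ℤ.+ + length q) m ≡ elevate u) (length-elevate u)
                 (sub-infix (xhat x) a L q (elevate u) s y≡′)

lemma11 : (n k : ℕ) .{{_ : NonZero n}} → 1 ≤ k → 2 * k + 1 ≤ n →
    (x : Vec Bool n) → InX n k x →
    (h : ℤ → ℤ) → IsHeight x h →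
    (A B : List ℤ) → InGamma x h (A , B) → Inverted x (A , B) →
    (hi : ℤ) → IsMax hi B →
    MatchedZeroHat x (hi ℤ.+ + 1)
lemma11 n k _ _ x _ h _ A B (a , L , (u , du , y≡1u0) , _ , _ , γ) inv hi hi-max
  with GamP-step x γ (sub-Reads x a L) inv hi-max
... | inside (at p c s y≡ pos x̂≡0) =
  subst (MatchedZeroHat x) pos (Dyck-subword-zero-matched x a L p s (subst Dyck (sym y≡1u0) (cat du ε)) y≡0)
  where
  c≡0 : c ≡ false
  c≡0 = trans (sub-lookup (xhat x) a L p c s y≡) (trans (cong (xhat x) pos) x̂≡0)
  y≡0 : sub (xhat x) a L ≡ p ++ false ∷ s
  y≡0 = subst (λ c → sub (xhat x) a L ≡ p ++ c ∷ s) c≡0 y≡
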